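{- Let $G$ be a graph which is bicycle-free at radius $r$. Let $\mathrm{Cyc}_{2r}(G)$ denote the collection of all cycles in $G$ of length at most $2r$. For each $C \in \mathrm{Cyc}_{2r}(G)$, let $C^+$ denote the set of vertices of $G$ within distance $r - \mathrm{len}(C)/2$ of $C$. Then the sets $\{C^+ : C \in \mathrm{Cyc}_{2r}(G)\}$ are pairwise disjoint.
   Context: The excess of a multigraph $H=(V,E)$ is $|E|-|V|$; a connected multigraph of excess $-1$ or $0$ is bicycle-free. A graph is bicycle-free at radius $r$ if the distance-$r$ neighborhood of every vertex is bicycle-free. $\mathrm{len}(C)$ is the length of cycle $C$. -}

module Defs where

open import Data.Nat using (ℕ; zero; suc; _+_; _*_; _≤_)
open import Data.Fin using (Fin; zero; suc; _≟_)
open import Data.Bool using (Bool; true; false; _∨_; _∧_)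
open import Data.Maybe using (Maybe; just; nothing; fromMaybe)
import Data.Maybe as Maybe
open import Data.Product using (Σ; ∃; _×_; _,_)
open import Data.Sum using (_⊎_)
open import Relation.Binary.PropositionalEquality using (_≡_)
open import Relation.Nullary.Decidable using (⌊_⌋)
open import Function.Definitions using (Injective)
open import Function.Bundles using (_⇔_)

-- A finite multigraph (loops and parallel edges allowed):
-- vertices Fin n, edges Fin m, each edge e has two (unordered) ends.
record MultiGraph : Set where
  field
    n    : ℕ
    m    : ℕ
    src  : Fin m → Fin n
    tgt  : Fin m → Fin n

open MultiGraph public

anyF : ∀ {k} → (Fin k → Bool) → Bool
anyF {zero}  p = false
anyF {suc k} p = p zero ∨ anyF (λ i → p (suc i))

boolToℕ : Bool → ℕ
boolToℕ true  = 1
boolToℕ false = 0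

countF : ∀ {k} → (Fin k → Bool) → ℕ
countF {zero}  p = 0
countF {suc k} p = boolToℕ (p zero) + countF (λ i → p (suc i))

Joins : (G : MultiGraph) → Fin (m G) → Fin (n G) → Fin (n G) → Set
Joins G e a b = (src G e ≡ a × tgt G e ≡ b) ⊎ (src G e ≡ b × tgt G e ≡ a)

within : (G : MultiGraph) → ℕ → Fin (n G) → Fin (n G) → Bool
within G zero    v u = ⌊ v ≟ u ⌋
within G (suc k) v u =
  within G k v u ∨
  anyF (λ e → (within G k v (src G e) ∧ ⌊ tgt G e ≟ u ⌋)
            ∨ (within G k v (tgt G e) ∧ ⌊ src G e ≟ u ⌋))

ballVertices : (G : MultiGraph) → ℕ → Fin (n G) → ℕ
ballVertices G r v = countF (within G r v)

ballEdges : (G : MultiGraph) → ℕ → Fin (n G) → ℕ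
ballEdges G r v = countF (λ e → within G r v (src G e) ∧ within G r v (tgt G e))

-- The ball is always connected, so it is bicycle-free iff its
-- excess |E| - |V| is -1 or 0, i.e. iff |E| ≤ |V|.
BicycleFreeAtRadius : MultiGraph → ℕ → Set
BicycleFreeAtRadius G r = ∀ v → ballEdges G r v ≤ ballVertices G r v

incr : ∀ {k} → Fin (suc k) → Maybe (Fin (suc k))
incr {zero}  zero    = nothing
incr {suc k} zero    = just (suc zero)
incr {suc k} (suc i) = Maybe.map suc (incr i)

next : ∀ {k} → Fin (suc k) → Fin (suc k)
next i = fromMaybe zero (incr i)

-- A cycle of length len = suc k: distinct vertices v_0..v_k and distinct
-- edges e_0..e_k, with e_i joining v_i and v_{i+1 mod len}.
-- (Loops give cycles of length 1, pairs of parallel edges of length 2.)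
record Cycle (G : MultiGraph) : Set where
  field
    k      : ℕ
    verts  : Fin (suc k) → Fin (n G)
    edges  : Fin (suc k) → Fin (m G)
    verts-inj : Injective _≡_ _≡_ verts
    edges-inj : Injective _≡_ _≡_ edges
    link   : ∀ i → Joins G (edges i) (verts i) (verts (next i))

  len : ℕ
  len = suc k

open Cycle public

-- v ∈ C⁺ (for len C ≤ 2r): dist(v, C) ≤ r - len(C)/2, i.e. there is a vertex
-- x of C and d with dist(x,v) ≤ d and 2d + len C ≤ 2r.
InPlus : (G : MultiGraph) → ℕ → Cycle G → Fin (n G) → Set
InPlus G r C v =
  Σ ℕ λ d → Σ (Fin (len C)) λ i →
    (within G d (verts C i) v ≡ true) × (2 * d + len C ≤ 2 * r)

-- Two cycles are the same cycle (as subgraphs) iff they have the same edge set.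
SameCycle : {G : MultiGraph} → Cycle G → Cycle G → Set
SameCycle C D = ∀ e → (∃ λ i → edges C i ≡ e) ⇔ (∃ λ j → edges D j ≡ e)

-- Fix v in C⁺ ∩ D⁺. Since any two vertices of a cycle are joined along it by a walk of at
-- most half its length, all of C and all of D lie in the ball B of radius r around v.
-- If C ≠ D, some edge e of C is not on D (or vice versa). Deleting e from B keeps it
-- connected (go around C instead), and deleting afterwards an edge of D, which avoids e,
-- still keeps it connected. A connected graph has at least |V| − 1 edges (map every
-- non-root vertex to the edge towards its BFS parent), so |E(B)| − 2 ≥ |V(B)| − 1: the ball
-- has positive excess, contradicting bicycle-freeness at radius r.
module Submission where

open import Defs
open import Data.Nat using (ℕ; zero; suc; _+_; _*_; _≤_; _<_; _∸_; z≤n; s≤s; NonZero)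
open import Data.Nat.Properties hiding (_≟_)
open import Data.Nat.DivMod
  using (_%_; _/_; _mod_; m≡m%n+[m/n]*n; m%n%n≡m%n; %-distribˡ-+; [m+n]%n≡m%n; n%n≡0; m<n⇒m%n≡m)
open import Data.Nat.Divisibility using (_∣_; ∣⇒≤; ∣m+n∣m⇒∣n; n∣m*n)
open import Data.Fin using (Fin; zero; suc; _≟_; toℕ; fromℕ; inject₁)
import Data.Fin.Properties as FinP
open import Data.Fin.Properties using (all?; any?; ¬∀⟶∃¬)
open import Data.Fin.Relation.Unary.Top using (view; ‵fromℕ; ‵inj₁)
import Data.Maybe as Maybe
open import Data.Bool using (Bool; true; false; T; _∧_; _∨_; not)
open import Data.Bool.Properties using (T-∧; T-∨; T?; T-≡; ∧-identityʳ)
open import Data.Empty using (⊥; ⊥-elim)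
open import Data.Product using (Σ; ∃; _×_; _,_; proj₁; proj₂)
open import Data.Sum using (_⊎_; inj₁; inj₂)
open import Function using (_∘_)
open import Function.Bundles using (Equivalence; mk⇔)
open import Relation.Binary.PropositionalEquality
open import Relation.Nullary using (¬_; yes; no; Dec; does)
open import Relation.Nullary.Decidable using (⌊_⌋; toWitness; fromWitness)
open import Relation.Unary using (Decidable)

open Equivalence using (to; from)

-- Counting subsets of Fin k

_∖_ : ∀ {k} → (Fin k → Bool) → Fin k → Fin k → Bool
(p ∖ j) i = p i ∧ not (does (i ≟ j))

∖-intro : ∀ {k} {p : Fin k → Bool} {i j} → T (p i) → i ≢ j → T ((p ∖ j) i)
∖-intro {i = i} {j} pi i≢j with i ≟ j
... | yes i≡j = ⊥-elim (i≢j i≡j)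
... | no _    = from T-∧ (pi , _)

∖-kept : ∀ {k} {p : Fin k → Bool} {i j} → T ((p ∖ j) i) → T (p i)
∖-kept h = proj₁ (to T-∧ h)

∖-removed : ∀ {k} {p : Fin k → Bool} {i j} → T ((p ∖ j) i) → i ≢ j
∖-removed {p = p} {i} {j} h with i ≟ j
... | no i≢j = i≢j
... | yes _  = ⊥-elim (proj₂ (to (T-∧ {p i}) h))

anyF-intro : ∀ {k} (p : Fin k → Bool) i → T (p i) → T (anyF p)
anyF-intro p zero    pi = from T-∨ (inj₁ pi)
anyF-intro p (suc i) pi = from (T-∨ {p zero}) (inj₂ (anyF-intro (p ∘ suc) i pi))

anyF-elim : ∀ {k} (p : Fin k → Bool) → T (anyF p) → ∃ λ i → T (p i)
anyF-elim {suc k} p h with to (T-∨ {p zero}) h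
... | inj₁ p0 = zero , p0
... | inj₂ ps with anyF-elim (p ∘ suc) ps
...   | i , pi = suc i , pi

anyF-cong : ∀ {k} {p q : Fin k → Bool} → (∀ i → p i ≡ q i) → anyF p ≡ anyF q
anyF-cong {zero}  eq = refl
anyF-cong {suc k} eq = cong₂ _∨_ (eq zero) (anyF-cong (eq ∘ suc))

countF-cong : ∀ {k} {p q : Fin k → Bool} → (∀ i → p i ≡ q i) → countF p ≡ countF q
countF-cong {zero}  eq = refl
countF-cong {suc k} eq = cong₂ (λ b c → boolToℕ b + c) (eq zero) (countF-cong (eq ∘ suc))

boolToℕ-true : ∀ {b} → T b → boolToℕ b ≡ 1
boolToℕ-true {true} _ = refl

boolToℕ-false : ∀ {b} → ¬ T b → boolToℕ b ≡ 0
boolToℕ-false {false} _  = refl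
boolToℕ-false {true}  ¬t = ⊥-elim (¬t _)

countF-remove : ∀ {k} (p : Fin k → Bool) j → T (p j) → countF p ≡ suc (countF (p ∖ j))
countF-remove p zero pj with p zero
... | true = cong suc (countF-cong (λ i → sym (∧-identityʳ (p (suc i)))))
countF-remove p (suc j) pj = begin
  boolToℕ (p zero) + countF (p ∘ suc)
    ≡⟨ cong (boolToℕ (p zero) +_) (countF-remove (p ∘ suc) j pj) ⟩
  boolToℕ (p zero) + suc (countF ((p ∘ suc) ∖ j))
    ≡⟨ +-suc (boolToℕ (p zero)) _ ⟩
  suc (boolToℕ (p zero) + countF ((p ∘ suc) ∖ j))
    ≡⟨ cong (λ b → suc (boolToℕ b + countF ((p ∘ suc) ∖ j))) (sym (∧-identityʳ (p zero))) ⟩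
  suc (countF (p ∖ suc j))
    ∎
  where open ≡-Reasoning

countF-injection : ∀ {a b} (p : Fin a → Bool) (q : Fin b → Bool) (f : ∀ i → T (p i) → Fin b) →
  (∀ i pi → T (q (f i pi))) → (∀ {i j} pi pj → f i pi ≡ f j pj → i ≡ j) → countF p ≤ countF q
countF-injection {zero}  p q f f∈q f-inj = z≤n
countF-injection {suc a} p q f f∈q f-inj with T? (p zero)
... | no ¬p0 = begin
  boolToℕ (p zero) + countF (p ∘ suc)
    ≡⟨ cong (_+ countF (p ∘ suc)) (boolToℕ-false ¬p0) ⟩
  countF (p ∘ suc)
    ≤⟨ countF-injection (p ∘ suc) q (f ∘ suc) (f∈q ∘ suc)
         (λ pi pj eq → FinP.suc-injective (f-inj pi pj eq)) ⟩
  countF q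
    ∎
  where open ≤-Reasoning
... | yes p0 = begin
  boolToℕ (p zero) + countF (p ∘ suc)
    ≡⟨ cong (_+ countF (p ∘ suc)) (boolToℕ-true p0) ⟩
  suc (countF (p ∘ suc))
    ≤⟨ s≤s (countF-injection (p ∘ suc) (q ∖ f zero p0) (f ∘ suc)
         (λ i pi → ∖-intro {p = q} (f∈q (suc i) pi) (λ eq → FinP.0≢1+n (f-inj p0 pi (sym eq))))
         (λ pi pj eq → FinP.suc-injective (f-inj pi pj eq))) ⟩
  suc (countF (q ∖ f zero p0))
    ≡⟨ sym (countF-remove q (f zero p0) (f∈q zero p0)) ⟩
  countF q
    ∎
  where open ≤-Reasoning

-- Arithmetic of ℕ and of positions modulo the length of a cycle

crossing-point : ∀ {p} (P : ℕ → Set p) → Decidable P → ¬ P 0 → ∀ {k} → P k →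
  ∃ λ ℓ → ¬ P ℓ × P (suc ℓ)
crossing-point P P? ¬P0 {zero}  Pk = ⊥-elim (¬P0 Pk)
crossing-point P P? ¬P0 {suc k} Pk with P? k
... | yes Pk′ = crossing-point P P? ¬P0 Pk′
... | no ¬Pk′ = k , ¬Pk′ , Pk

x+y≡z⇒2x≤z⊎2y≤z : ∀ x y {z} → x + y ≡ z → 2 * x ≤ z ⊎ 2 * y ≤ z
x+y≡z⇒2x≤z⊎2y≤z x y refl with ≤-total x y
... | inj₁ x≤y = inj₁ (+-monoʳ-≤ x (subst (_≤ y) (sym (+-identityʳ x)) x≤y))
... | inj₂ y≤x = inj₂ (subst (y + (y + 0) ≤_) (+-comm y x)
                    (+-monoʳ-≤ y (subst (_≤ x) (sym (+-identityʳ y)) y≤x)))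

[m+n]%o≡n%o⇒o∣m : ∀ m n o .{{_ : NonZero o}} → (m + n) % o ≡ n % o → o ∣ m
[m+n]%o≡n%o⇒o∣m m n o eq =
  ∣m+n∣m⇒∣n (subst (o ∣_) quotients (n∣m*n ((m + n) / o))) (n∣m*n (n / o))
  where
  open ≡-Reasoning
  quotients : (m + n) / o * o ≡ n / o * o + m
  quotients = +-cancelˡ-≡ (n % o) _ _ (begin
    n % o + (m + n) / o * o         ≡⟨ cong (_+ (m + n) / o * o) (sym eq) ⟩
    (m + n) % o + (m + n) / o * o   ≡⟨ sym (m≡m%n+[m/n]*n (m + n) o) ⟩
    m + n                           ≡⟨ cong (m +_) (m≡m%n+[m/n]*n n o) ⟩
    m + (n % o + n / o * o)         ≡⟨ +-comm m _ ⟩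
    n % o + n / o * o + m           ≡⟨ +-assoc (n % o) _ m ⟩
    n % o + (n / o * o + m)         ∎)

next-inject₁ : ∀ {k} (j : Fin k) → next (inject₁ j) ≡ suc j
next-inject₁ j = cong (Maybe.fromMaybe zero) (incr-inject₁ j)
  where
  incr-inject₁ : ∀ {k} (j : Fin k) → incr (inject₁ j) ≡ Maybe.just (suc j)
  incr-inject₁ {suc k} zero    = refl
  incr-inject₁ {suc k} (suc j) = cong (Maybe.map suc) (incr-inject₁ j)

next-fromℕ : ∀ k → next (fromℕ k) ≡ zero
next-fromℕ k = cong (Maybe.fromMaybe zero) (incr-fromℕ k)
  where
  incr-fromℕ : ∀ k → incr (fromℕ k) ≡ Maybe.nothing
  incr-fromℕ zero    = refl
  incr-fromℕ (suc k) = cong (Maybe.map suc) (incr-fromℕ k)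

toℕ-next : ∀ {k} (i : Fin (suc k)) → toℕ (next i) ≡ suc (toℕ i) % suc k
toℕ-next {k} i with view i
... | ‵fromℕ = begin
  toℕ (next (fromℕ k))          ≡⟨ cong toℕ (next-fromℕ k) ⟩
  0                             ≡⟨ sym (n%n≡0 (suc k)) ⟩
  suc k % suc k                 ≡⟨ cong (λ x → suc x % suc k) (sym (FinP.toℕ-fromℕ k)) ⟩
  suc (toℕ (fromℕ k)) % suc k   ∎
  where open ≡-Reasoning
... | ‵inj₁ {i = j} _ = begin
  toℕ (next (inject₁ j))        ≡⟨ cong toℕ (next-inject₁ j) ⟩
  suc (toℕ j)                   ≡⟨ sym (m<n⇒m%n≡m (s≤s (FinP.toℕ<n j))) ⟩
  suc (toℕ j) % suc k           ≡⟨ cong (λ x → suc x % suc k) (sym (FinP.toℕ-inject₁ j)) ⟩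
  suc (toℕ (inject₁ j)) % suc k ∎
  where open ≡-Reasoning

mod-cong : ∀ {a b n} .{{_ : NonZero n}} → a % n ≡ b % n → a mod n ≡ b mod n
mod-cong eq =
  FinP.toℕ-injective (trans (FinP.toℕ-fromℕ< _) (trans eq (sym (FinP.toℕ-fromℕ< _))))

mod-injective : ∀ {a b n} .{{_ : NonZero n}} → a mod n ≡ b mod n → a % n ≡ b % n
mod-injective eq = trans (sym (FinP.toℕ-fromℕ< _)) (trans (cong toℕ eq) (FinP.toℕ-fromℕ< _))

toℕ-mod : ∀ {k} (i : Fin (suc k)) → toℕ i mod suc k ≡ i
toℕ-mod i = FinP.toℕ-injective (trans (FinP.toℕ-fromℕ< _) (m<n⇒m%n≡m (FinP.toℕ<n i)))

next-mod : ∀ a k → next (a mod suc k) ≡ suc a mod suc k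
next-mod a k = FinP.toℕ-injective (begin
  toℕ (next (a mod L))      ≡⟨ toℕ-next (a mod L) ⟩
  suc (toℕ (a mod L)) % L   ≡⟨ cong (λ x → suc x % L) (FinP.toℕ-fromℕ< _) ⟩
  (1 + a % L) % L           ≡⟨ %-distribˡ-+ 1 (a % L) L ⟩
  (1 % L + a % L % L) % L   ≡⟨ cong (λ x → (1 % L + x) % L) (m%n%n≡m%n a L) ⟩
  (1 % L + a % L) % L       ≡⟨ sym (%-distribˡ-+ 1 a L) ⟩
  suc a % L                 ≡⟨ sym (FinP.toℕ-fromℕ< _) ⟩
  toℕ (suc a mod L)         ∎)
  where
  open ≡-Reasoning
  L : ℕ
  L = suc k

-- Walks and breadth-first search

module _ (G : MultiGraph) where

  Joins-sym : ∀ {e a b} → Joins G e a b → Joins G e b a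
  Joins-sym (inj₁ ends) = inj₂ ends
  Joins-sym (inj₂ ends) = inj₁ ends

  Joins-ends : ∀ {e a b c d} → Joins G e a b → Joins G e c d →
    (a ≡ c × b ≡ d) ⊎ (a ≡ d × b ≡ c)
  Joins-ends (inj₁ (refl , refl)) (inj₁ (refl , refl)) = inj₁ (refl , refl)
  Joins-ends (inj₁ (refl , refl)) (inj₂ (refl , refl)) = inj₂ (refl , refl)
  Joins-ends (inj₂ (refl , refl)) (inj₁ (refl , refl)) = inj₂ (refl , refl)
  Joins-ends (inj₂ (refl , refl)) (inj₂ (refl , refl)) = inj₁ (refl , refl)

  record Step (A : Fin (m G) → Bool) (b c : Fin (n G)) : Set where
    constructor step
    field
      edge    : Fin (m G)
      allowed : T (A edge)
      joins   : Joins G edge b c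

  Step-sym : ∀ {A b c} → Step A b c → Step A c b
  Step-sym (step e ae je) = step e ae (Joins-sym je)

  -- The index k of Walk A k a b is an upper bound on the length of the walk.
  data Walk (A : Fin (m G) → Bool) : ℕ → Fin (n G) → Fin (n G) → Set where
    stop : ∀ {k a} → Walk A k a a
    _▷_  : ∀ {k a b c} → Walk A k a b → Step A b c → Walk A (suc k) a c

  Reachable : (Fin (m G) → Bool) → Fin (n G) → Fin (n G) → Set
  Reachable A a b = Σ ℕ λ k → Walk A k a b

  Walk-≤ : ∀ {A j k a b} → j ≤ k → Walk A j a b → Walk A k a b
  Walk-≤ j≤k       stop    = stop
  Walk-≤ (s≤s j≤k) (p ▷ s) = Walk-≤ j≤k p ▷ s

  _◅_ : ∀ {A k a b c} → Step A a b → Walk A k b c → Walk A (suc k) a c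
  s ◅ stop    = stop ▷ s
  s ◅ (p ▷ t) = (s ◅ p) ▷ t

  reverse : ∀ {A k a b} → Walk A k a b → Walk A k b a
  reverse stop    = stop
  reverse (p ▷ s) = Step-sym s ◅ reverse p

  _++_ : ∀ {A j k a b c} → Walk A j a b → Walk A k b c → Walk A (k + j) a c
  _++_ {k = k} p stop = Walk-≤ (m≤n+m _ k) p
  p ++ (q ▷ s)        = (p ++ q) ▷ s

  allEdges : Fin (m G) → Bool
  allEdges _ = true

  withinVia : (Fin (m G) → Bool) → ℕ → Fin (n G) → Fin (n G) → Bool
  entersVia : (Fin (m G) → Bool) → ℕ → Fin (n G) → Fin (n G) → Fin (m G) → Bool

  withinVia A zero    a b = ⌊ a ≟ b ⌋
  withinVia A (suc k) a b = withinVia A k a b ∨ anyF (entersVia A k a b)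

  entersVia A k a b e = A e ∧ ((withinVia A k a (src G e) ∧ ⌊ tgt G e ≟ b ⌋)
                             ∨ (withinVia A k a (tgt G e) ∧ ⌊ src G e ≟ b ⌋))

  within-withinVia : ∀ k a b → within G k a b ≡ withinVia allEdges k a b
  within-withinVia zero    a b = refl
  within-withinVia (suc k) a b = cong₂ _∨_ (within-withinVia k a b) (anyF-cong λ e →
    cong₂ _∨_ (cong (_∧ ⌊ tgt G e ≟ b ⌋) (within-withinVia k a (src G e)))
              (cong (_∧ ⌊ src G e ≟ b ⌋) (within-withinVia k a (tgt G e))))

  withinVia-suc : ∀ {A k a c} → T (withinVia A (suc k) a c) →
    T (withinVia A k a c) ⊎ ∃ λ b → Step A b c × T (withinVia A k a b)
  withinVia-suc {A} {k} {a} {c} h with to (T-∨ {withinVia A k a c}) h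
  ... | inj₁ near = inj₁ near
  ... | inj₂ via with anyF-elim (entersVia A k a c) via
  ...   | e , he with to (T-∧ {A e}) he
  ...     | ae , ends with to (T-∨ {withinVia A k a (src G e) ∧ ⌊ tgt G e ≟ c ⌋}) ends
  ...       | inj₁ fwd = let (w , t≡c) = to T-∧ fwd in
                           inj₂ (_ , step e ae (inj₁ (refl , toWitness t≡c)) , w)
  ...       | inj₂ bwd = let (w , s≡c) = to T-∧ bwd in
                           inj₂ (_ , step e ae (inj₂ (toWitness s≡c , refl)) , w)

  withinVia⇒Walk : ∀ {A} k {a b} → T (withinVia A k a b) → Walk A k a b
  withinVia⇒Walk zero    h with refl ← toWitness h = stop
  withinVia⇒Walk {A} (suc k) {a} {b} h with withinVia-suc {A} {k} {a} {b} h
  ... | inj₁ near          = Walk-≤ (n≤1+n k) (withinVia⇒Walk k near)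
  ... | inj₂ (_ , s , w)   = withinVia⇒Walk k w ▷ s

  withinVia-step : ∀ {A k a b c} → T (withinVia A k a b) → Step A b c →
    T (withinVia A (suc k) a c)
  withinVia-step {A} {k} {a} w (step e ae (inj₁ (refl , refl))) =
    from (T-∨ {withinVia A k a (tgt G e)}) (inj₂ (anyF-intro (entersVia A k a (tgt G e)) e
      (from T-∧ (ae , from T-∨ (inj₁ (from T-∧ (w , fromWitness refl)))))))
  withinVia-step {A} {k} {a} w (step e ae (inj₂ (refl , refl))) =
    from (T-∨ {withinVia A k a (src G e)}) (inj₂ (anyF-intro (entersVia A k a (src G e)) e
      (from T-∧ (ae , from (T-∨ {withinVia A k a (src G e) ∧ ⌊ tgt G e ≟ src G e ⌋})
                           (inj₂ (from T-∧ (w , fromWitness refl)))))))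

  Walk⇒withinVia : ∀ {A k a b} → Walk A k a b → T (withinVia A k a b)
  Walk⇒withinVia {k = zero}           stop    = fromWitness refl
  Walk⇒withinVia {A} {suc k} {a} {b}  stop    =
    from (T-∨ {withinVia A k a b}) (inj₁ (Walk⇒withinVia {A} {k} {a} stop))
  Walk⇒withinVia {A} {suc k} {a}      (p ▷ s) = withinVia-step {A} {k} {a} (Walk⇒withinVia p) s

  withinVia-mono : ∀ {A j k a b} → j ≤ k → T (withinVia A j a b) → T (withinVia A k a b)
  withinVia-mono {j = j} j≤k h = Walk⇒withinVia (Walk-≤ j≤k (withinVia⇒Walk j h))

  within⇒Walk : ∀ {k a b} → within G k a b ≡ true → Walk allEdges k a b
  within⇒Walk {k} {a} {b} h = withinVia⇒Walk k (subst T (within-withinVia k a b) (from T-≡ h))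

  Walk⇒within : ∀ {k a b} → Walk allEdges k a b → within G k a b ≡ true
  Walk⇒within {k} {a} {b} p = to T-≡ (subst T (sym (within-withinVia k a b)) (Walk⇒withinVia p))

  record BFSParent (A : Fin (m G) → Bool) (x u : Fin (n G)) : Set where
    field
      parent : Fin (n G)
      depth  : ℕ
      via    : Step A parent u
      parent-within : T (withinVia A depth x parent)
      child-beyond  : ¬ T (withinVia A depth x u)

  open BFSParent

  bfs-parent : ∀ {A x u} → Reachable A x u → u ≢ x → BFSParent A x u
  bfs-parent {A} {x} {u} (k , walk) u≢x
    with crossing-point (λ d → T (withinVia A d x u)) (λ d → T? _)
                        (λ h → u≢x (sym (toWitness h))) {k} (Walk⇒withinVia walk)
  ... | ℓ , beyond , within with withinVia-suc {A = A} {k = ℓ} {a = x} {c = u} within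
  ...   | inj₁ near = ⊥-elim (beyond near)
  ...   | inj₂ (w , s , w-within) = record
    { parent = w ; depth = ℓ ; via = s ; parent-within = w-within ; child-beyond = beyond }

  -- Two children sharing a parent edge would each be strictly closer to the root than the other.
  BFSParent-injective : ∀ {A x u u′} (P : BFSParent A x u) (P′ : BFSParent A x u′) →
    Step.edge (via P) ≡ Step.edge (via P′) → u ≡ u′
  BFSParent-injective {A} {x} {u} {u′} P P′ same-edge
    with Joins-ends (Step.joins (via P))
                    (subst (λ e → Joins G e _ u′) (sym same-edge) (Step.joins (via P′)))
  ... | inj₁ (_ , u≡u′) = u≡u′
  ... | inj₂ (refl , refl) with ≤-total (depth P) (depth P′)
  ...   | inj₁ d≤d′ = ⊥-elim (child-beyond P′ (withinVia-mono d≤d′ (parent-within P)))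
  ...   | inj₂ d′≤d = ⊥-elim (child-beyond P (withinVia-mono d′≤d (parent-within P′)))

  connected⇒countF≤suc : ∀ (p : Fin (n G) → Bool) (A : Fin (m G) → Bool) x → T (p x) →
    (∀ u → T (p u) → Reachable A x u) → countF p ≤ suc (countF A)
  connected⇒countF≤suc p A x px reach = begin
    countF p              ≡⟨ countF-remove p x px ⟩
    suc (countF (p ∖ x))  ≤⟨ s≤s (countF-injection (p ∖ x) A parent-edge
                                 (λ u pu → Step.allowed (via (parentOf u pu)))
                                 (λ pu pu′ →
                                   BFSParent-injective (parentOf _ pu) (parentOf _ pu′))) ⟩
    suc (countF A)        ∎
    where
    open ≤-Reasoning
    parentOf : ∀ u → T ((p ∖ x) u) → BFSParent A x u
    parentOf u pu = bfs-parent (reach u (∖-kept {p = p} pu)) (∖-removed {p = p} pu)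
    parent-edge : ∀ u → T ((p ∖ x) u) → Fin (m G)
    parent-edge u pu = Step.edge (via (parentOf u pu))

  -- Walks along a cycle

  module _ (X : Cycle G) where

    vertexAt : ℕ → Fin (n G)
    vertexAt a = verts X (a mod len X)

    edgeAt : ℕ → Fin (m G)
    edgeAt a = edges X (a mod len X)

    stepAt : ∀ {A} a → T (A (edgeAt a)) → Step A (vertexAt a) (vertexAt (suc a))
    stepAt a ae = step (edgeAt a) ae (subst (Joins G (edgeAt a) (vertexAt a))
                                            (cong (verts X) (next-mod a (k X)))
                                            (link X (a mod len X)))

    walk-along : ∀ {A} d a → (∀ l → l < d → T (A (edgeAt (l + a)))) →
      Walk A d (vertexAt a) (vertexAt (d + a))
    walk-along zero    a on-A = stop
    walk-along (suc d) a on-A =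
      walk-along d a (λ l l<d → on-A l (m<n⇒m<1+n l<d)) ▷ stepAt (d + a) (on-A d ≤-refl)

    vertexAt-periodic : ∀ a → vertexAt (len X + a) ≡ vertexAt a
    vertexAt-periodic a = cong (verts X) (mod-cong {a = len X + a} {b = a} (begin
      (len X + a) % len X   ≡⟨ cong (_% len X) (+-comm (len X) a) ⟩
      (a + len X) % len X   ≡⟨ [m+n]%n≡m%n a (len X) ⟩
      a % len X             ∎))
      where open ≡-Reasoning

    vertexAt-toℕ : ∀ i → vertexAt (toℕ i) ≡ verts X i
    vertexAt-toℕ i = cong (verts X) (toℕ-mod i)

    -- Go d steps forward or len X ∸ d steps backward, whichever is at most half the cycle.
    positions-close : ∀ a d → d ≤ len X →
      Σ ℕ λ t → 2 * t ≤ len X × Walk allEdges t (vertexAt a) (vertexAt (d + a))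
    positions-close a d d≤len with x+y≡z⇒2x≤z⊎2y≤z d (len X ∸ d) (m+[n∸m]≡n d≤len)
    ... | inj₁ forward  = d , forward , walk-along d a (λ _ _ → _)
    ... | inj₂ backward = len X ∸ d , backward ,
      reverse (subst (Walk allEdges (len X ∸ d) (vertexAt (d + a))) around
                     (walk-along (len X ∸ d) (d + a) (λ _ _ → _)))
      where
      around : vertexAt (len X ∸ d + (d + a)) ≡ vertexAt a
      around = trans (cong vertexAt (trans (sym (+-assoc (len X ∸ d) d a))
                                           (cong (_+ a) (m∸n+n≡m d≤len))))
                     (vertexAt-periodic a)

    vertices-close-≤ : ∀ i j → toℕ i ≤ toℕ j →
      Σ ℕ λ t → 2 * t ≤ len X × Walk allEdges t (verts X i) (verts X j)
    vertices-close-≤ i j i≤j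
      with positions-close (toℕ i) (toℕ j ∸ toℕ i)
                           (≤-trans (m∸n≤m (toℕ j) (toℕ i)) (<⇒≤ (FinP.toℕ<n j)))
    ... | t , half , w = t , half , subst₂ (Walk allEdges t) (vertexAt-toℕ i)
      (trans (cong vertexAt (m∸n+n≡m i≤j)) (vertexAt-toℕ j)) w

    vertices-close : ∀ i j →
      Σ ℕ λ t → 2 * t ≤ len X × Walk allEdges t (verts X i) (verts X j)
    vertices-close i j with ≤-total (toℕ i) (toℕ j)
    ... | inj₁ i≤j = vertices-close-≤ i j i≤j
    ... | inj₂ j≤i with vertices-close-≤ j i j≤i
    ...   | t , half , w = t , half , reverse w

    -- The other len X − 1 edges, walked forward from next i, lead back to i.
    cycle-detour : ∀ {A} i → (∀ l → l ≢ i → T (A (edges X l))) →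
      Reachable A (verts X (next i)) (verts X i)
    cycle-detour {A} i avoids =
      k X , subst₂ (Walk A (k X)) start end (walk-along (k X) (suc a) others)
      where
      a : ℕ
      a = toℕ i
      start : vertexAt (suc a) ≡ verts X (next i)
      start = cong (verts X) (trans (sym (next-mod a (k X))) (cong next (toℕ-mod i)))
      end : vertexAt (k X + suc a) ≡ verts X i
      end = trans (cong vertexAt (+-suc (k X) a)) (trans (vertexAt-periodic a) (vertexAt-toℕ i))
      others : ∀ l → l < k X → T (A (edgeAt (l + suc a)))
      others l l<k = avoids _ λ same →
        <⇒≱ (s≤s l<k) (∣⇒≤ ([m+n]%o≡n%o⇒o∣m (suc l) a (len X) (wraps-around l same)))
        where
        wraps-around : ∀ l → (l + suc a) mod len X ≡ i → (suc l + a) % len X ≡ a % len X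
        wraps-around l same = trans (cong (_% len X) (sym (+-suc l a)))
          (mod-injective {a = l + suc a} {b = a} (trans same (sym (toℕ-mod i))))

    cycle-detour-avoiding : ∀ {A} i → (∀ l → T (A (edges X l))) →
      Reachable (A ∖ edges X i) (verts X (next i)) (verts X i)
    cycle-detour-avoiding {A} i on-A =
      cycle-detour i (λ l l≢i → ∖-intro {p = A} (on-A l) (λ eq → l≢i (edges-inj X eq)))

    Walk-avoiding : ∀ {A} i → (∀ l → T (A (edges X l))) → ∀ {k a b} → Walk A k a b →
      Reachable (A ∖ edges X i) a b
    Walk-avoiding i on-A stop = 0 , stop
    Walk-avoiding {A} i on-A (p ▷ step e ae je) with e ≟ edges X i | Walk-avoiding i on-A p
    ... | no e≢eᵢ  | k′ , p′ = suc k′ , p′ ▷ step e (∖-intro {p = A} ae e≢eᵢ) je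
    ... | yes refl | k′ , p′ with Joins-ends je (link X i)
    ...   | inj₁ (refl , refl) = _ , p′ ++ reverse (proj₂ (cycle-detour-avoiding i on-A))
    ...   | inj₂ (refl , refl) = _ , p′ ++ proj₂ (cycle-detour-avoiding i on-A)

  -- Two distinct cycles in a connected graph

  EdgeOf : Cycle G → Fin (m G) → Set
  EdgeOf X e = ∃ λ j → edges X j ≡ e

  edgeOf? : ∀ X e → Dec (EdgeOf X e)
  edgeOf? X e = any? (λ j → edges X j ≟ e)

  PrivateEdge : Cycle G → Cycle G → Set
  PrivateEdge C D = ∃ λ i → ¬ EdgeOf D (edges C i)

  private-edge : ∀ C D → ¬ SameCycle C D → PrivateEdge C D ⊎ PrivateEdge D C
  private-edge C D C≠D
    with all? (λ i → edgeOf? D (edges C i)) | all? (λ j → edgeOf? C (edges D j))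
  ... | no C⊈D  | _        = inj₁ (¬∀⟶∃¬ _ _ (λ i → edgeOf? D (edges C i)) C⊈D)
  ... | yes _   | no D⊈C   = inj₂ (¬∀⟶∃¬ _ _ (λ j → edgeOf? C (edges D j)) D⊈C)
  ... | yes C⊆D | yes D⊆C =
    ⊥-elim (C≠D λ e → mk⇔ (λ { (i , refl) → C⊆D i }) (λ { (j , refl) → D⊆C j }))

  -- D avoids the edge C i, so it is still a cycle after C i is deleted, and D 0 can be
  -- deleted in turn without disconnecting p.
  two-cycles⇒countF< : ∀ (p : Fin (n G) → Bool) (A : Fin (m G) → Bool) x → T (p x) →
    (∀ u → T (p u) → Reachable A x u) → (C D : Cycle G) →
    (∀ l → T (A (edges C l))) → (∀ l → T (A (edges D l))) →
    ∀ i → ¬ EdgeOf D (edges C i) → countF p < countF A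
  two-cycles⇒countF< p A x px reach C D C⊆A D⊆A i i∉D = begin-strict
    countF p               ≤⟨ connected⇒countF≤suc p A″ x px reach″ ⟩
    suc (countF A″)        <⟨ n<1+n _ ⟩
    suc (suc (countF A″))  ≡⟨ cong suc (sym (countF-remove A′ (edges D zero) (D⊆A′ zero))) ⟩
    suc (countF A′)        ≡⟨ sym (countF-remove A (edges C i) (C⊆A i)) ⟩
    countF A               ∎
    where
    open ≤-Reasoning
    A′ A″ : Fin (m G) → Bool
    A′ = A ∖ edges C i
    A″ = A′ ∖ edges D zero
    D⊆A′ : ∀ l → T (A′ (edges D l))
    D⊆A′ l = ∖-intro {p = A} (D⊆A l) (λ same → i∉D (l , same))
    reach″ : ∀ u → T (p u) → Reachable A″ x u
    reach″ u pu =
      Walk-avoiding D zero D⊆A′ (proj₂ (Walk-avoiding C i C⊆A (proj₂ (reach u pu))))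

  -- Balls

  induced : (Fin (n G) → Bool) → Fin (m G) → Bool
  induced q e = q (src G e) ∧ q (tgt G e)

  Joins⇒induced : ∀ {q e b c} → Joins G e b c → T (q b) → T (q c) → T (induced q e)
  Joins⇒induced (inj₁ (refl , refl)) qb qc = from T-∧ (qb , qc)
  Joins⇒induced (inj₂ (refl , refl)) qb qc = from T-∧ (qc , qb)

  cycle-edges-induced : ∀ q (X : Cycle G) → (∀ j → T (q (verts X j))) →
    ∀ l → T (induced q (edges X l))
  cycle-edges-induced q X on-q l = Joins⇒induced {q = q} (link X l) (on-q l) (on-q (next l))

  module _ (r : ℕ) (v : Fin (n G)) where

    Walk⇒in-ball : ∀ {k u} → Walk allEdges k v u → k ≤ r → T (within G r v u)
    Walk⇒in-ball p k≤r = from T-≡ (Walk⇒within (Walk-≤ k≤r p))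

    Walk-in-ball : ∀ {k u} → Walk allEdges k v u → k ≤ r → Walk (induced (within G r v)) k v u
    Walk-in-ball         stop              k≤r = stop
    Walk-in-ball {suc k} (p ▷ step e _ je) k≤r = Walk-in-ball p k≤r′ ▷ step e
      (Joins⇒induced je (Walk⇒in-ball p k≤r′) (Walk⇒in-ball (p ▷ step e _ je) k≤r)) je
      where
      k≤r′ : k ≤ r
      k≤r′ = ≤-trans (n≤1+n k) k≤r

    ball-connected : ∀ u → T (within G r v u) → Reachable (induced (within G r v)) v u
    ball-connected u h = r , Walk-in-ball (within⇒Walk (to T-≡ h)) ≤-refl

    InPlus⇒cycle-in-ball : ∀ X → InPlus G r X v → ∀ j → T (within G r v (verts X j))
    InPlus⇒cycle-in-ball X (d , i , near , bound) j with vertices-close X i j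
    ... | t , 2t≤len , along = Walk⇒in-ball (reverse (within⇒Walk near) ++ along)
      (*-cancelˡ-≤ 2 (begin
        2 * (t + d)      ≡⟨ *-distribˡ-+ 2 t d ⟩
        2 * t + 2 * d    ≤⟨ +-monoˡ-≤ (2 * d) 2t≤len ⟩
        len X + 2 * d    ≡⟨ +-comm (len X) (2 * d) ⟩
        2 * d + len X    ≤⟨ bound ⟩
        2 * r            ∎))
      where open ≤-Reasoning

    cycles-near⇒ballVertices<ballEdges : ∀ C D → InPlus G r C v → InPlus G r D v →
      PrivateEdge C D → ballVertices G r v < ballEdges G r v
    cycles-near⇒ballVertices<ballEdges C D C⁺v D⁺v (i , i∉D) =
      two-cycles⇒countF< (within G r v) (induced (within G r v)) v (Walk⇒in-ball stop z≤n)
        ball-connected C D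
        (cycle-edges-induced (within G r v) C (InPlus⇒cycle-in-ball C C⁺v))
        (cycle-edges-induced (within G r v) D (InPlus⇒cycle-in-ball D D⁺v)) i i∉D

proposition2p16 : (G : MultiGraph) (r : ℕ) → BicycleFreeAtRadius G r →
    (C D : Cycle G) → len C ≤ 2 * r → len D ≤ 2 * r → ¬ SameCycle C D →
    (v : Fin (n G)) → ¬ (InPlus G r C v × InPlus G r D v)
proposition2p16 G r bicycle-free C D _ _ C≠D v (C⁺v , D⁺v) with private-edge G C D C≠D
... | inj₁ C∖D = <⇒≱ (cycles-near⇒ballVertices<ballEdges G r v C D C⁺v D⁺v C∖D) (bicycle-free v)
... | inj₂ D∖C = <⇒≱ (cycles-near⇒ballVertices<ballEdges G r v D C D⁺v C⁺v D∖C) (bicycle-free v)
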